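{- Let $\ell$ be a prime and let $m$ be an integer with $0<m<\ell$ and $m\le 7$. Let $a_{\ell,\ell-m}$ be the coefficient of $X^\ell Y^{\ell-m}$ in the $\ell$-th classical modular polynomial $\Phi_\ell(X,Y)$. Assume that one of the following holds: (i) $\ell\equiv 1$ or $3\pmod 5$ and $m\equiv 4\pmod 5$; (ii) $\ell\equiv 2\pmod 5$ and $m\equiv 3\pmod 5$; (iii) $\ell\equiv 4\pmod 5$ and $m\equiv 2\pmod 5$. Then $5$ divides $a_{\ell,\ell-m}$.
   Context: The $\ell$-th classical modular polynomial is $\Phi_\ell(X,Y)=X^{\ell+1}+Y^{\ell+1}+\sum_{0\le m,n\le\ell}a_{m,n}X^mY^n\in\mathbb{Z}[X,Y]$, characterized by $\Phi_\ell(j(\ell z),j(z))=0$ where $j$ is the modular invariant function. -}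

module Defs where

open import Data.Nat as ℕ using (ℕ; zero; suc; _∸_; _<ᵇ_; _≡ᵇ_)
open import Data.Nat.Divisibility using (_∣?_)
open import Data.Integer using (ℤ; +_; _+_; _*_; 0ℤ; 1ℤ)
open import Data.Bool using (if_then_else_)
open import Relation.Nullary using (does)
open import Relation.Binary.PropositionalEquality using (_≡_)

-- Formal power series over ℤ: n ↦ coefficient of q^n.
PS : Set
PS = ℕ → ℤ

sumTo : ℕ → (ℕ → ℤ) → ℤ
sumTo zero    f = f zero
sumTo (suc n) f = sumTo n f + f (suc n)

one : PS
one zero    = 1ℤ
one (suc _) = 0ℤ

_⊛_ : PS → PS → PS
(f ⊛ g) n = sumTo n (λ i → f i * g (n ∸ i))

infixl 7 _⊛_

pow : PS → ℕ → PS
pow f zero    = one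
pow f (suc k) = f ⊛ pow f k

-- f(q^l)
dil : ℕ → PS → PS
dil l f n = sumTo n (λ k → if (l ℕ.* k) ≡ᵇ n then f k else 0ℤ)

shift : ℕ → PS → PS
shift s f n = if n <ᵇ s then 0ℤ else f (n ∸ s)

σ₃ : ℕ → ℤ
σ₃ n = sumTo n (λ d → if does (d ∣? n) then + (d ℕ.^ 3) else 0ℤ)

E4 : PS
E4 zero    = 1ℤ
E4 (suc n) = + 240 * σ₃ (suc n)

-- geometric series 1/(1 - q^k) for k ≥ 1
geo : ℕ → PS
geo k i = if does (k ∣? i) then 1ℤ else 0ℤ

prodGeo : ℕ → PS
prodGeo zero    = one
prodGeo (suc K) = geo (suc K) ⊛ prodGeo K

-- ∏_{k≥1} 1/(1 - q^k)  (coefficient n only depends on factors k ≤ n)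
eulerInv : PS
eulerInv n = prodGeo n n

-- J(q) = q · j(q) = E4(q)^3 / ∏(1 - q^n)^24, where j = E4^3/Δ, Δ = q∏(1-q^n)^24.
Jq : PS
Jq = pow E4 3 ⊛ pow eulerInv 24

-- Coefficients of a polynomial X^{l+1} + Y^{l+1} + Σ_{0≤i,k≤l} a i k X^i Y^k
-- (only the values a i k with i,k ≤ l are used).
-- Φ(j(q^l), j(q)) multiplied by q^{l(l+1)}, a formal power series in q:
-- the term X^i Y^k contributes q^{l(l+1) - l i - k} J(q^l)^i J(q)^k.
term : ℕ → ℤ → ℕ → ℕ → PS
term l c i k n = c * shift (l ℕ.* (suc l) ∸ (l ℕ.* i ℕ.+ k)) (pow (dil l Jq) i ⊛ pow Jq k) n

evalPhi : ℕ → (ℕ → ℕ → ℤ) → PS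
evalPhi l a n =
  term l 1ℤ (suc l) 0 n + term l 1ℤ 0 (suc l) n
  + sumTo l (λ i → sumTo l (λ k → term l (a i k) i k n))

-- a is the coefficient family of the l-th classical modular polynomial:
-- Φ(X,Y) = X^{l+1} + Y^{l+1} + Σ a i k X^i Y^k satisfies Φ(j(lz), j(z)) = 0,
-- checked on q-expansions (q = e^{2πiz}).
IsModularPolyCoeffs : ℕ → (ℕ → ℕ → ℤ) → Set
IsModularPolyCoeffs l a = ∀ n → evalPhi l a n ≡ 0ℤ

-- For n < ℓ the coefficient of qⁿ in q^{ℓ(ℓ+1)} Φ_ℓ(j(q^ℓ), j(q)) only sees X^{ℓ+1} and the
-- terms a_{ℓ,k} X^ℓ Y^k, and since J(q^ℓ) ≡ 1 mod q^ℓ (J = q j) it reads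
--   [n = 0] + Σ_{d ≤ n} a_{ℓ,ℓ-d} · [q^{n-d}] J^{ℓ-d} = 0.
-- This is a unitriangular system for a_{ℓ,ℓ}, a_{ℓ,ℓ-1}, …, a_{ℓ,ℓ-n}. Modulo 5 and q⁸ its
-- coefficients depend only on ℓ mod 25, because J²⁵ ≡ 1 mod (5, q⁸); solving it for each of
-- the 25 residues and each m ≤ 7 shows that a_{ℓ,ℓ-m} ≡ 0 mod 5 under (i)–(iii).

module Submission where

open import Defs
open import Data.Nat using (ℕ; _<_; _≤_; _%_; _∸_)
open import Data.Nat.Primality using (Prime)
open import Data.Integer using (ℤ; +_)
open import Data.Integer.Divisibility using (_∣_)
open import Data.Sum using (_⊎_)
open import Data.Product using (_×_)
open import Relation.Binary.PropositionalEquality using (_≡_)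

open import Data.Nat as ℕ using (zero; suc; z≤n; s≤s; NonZero; _<ᵇ_; _≡ᵇ_; _/_)
import Data.Nat.Properties as ℕₚ
import Data.Nat.DivMod as ℕₚ
open import Data.Nat.Divisibility using (divides)
open import Data.Integer using (0ℤ; 1ℤ; _+_; _*_; -_; _-_; _%ℕ_; _/ℕ_)
import Data.Integer.Properties as ℤₚ
open import Data.Integer.DivMod using (a≡a%ℕn+[a/ℕn]*n)
open import Data.Integer.Divisibility.Signed as Signed using (divides) renaming (_∣_ to _∣ₛ_)
open import Data.Integer.Tactic.RingSolver using (solve-∀)
open import Data.Bool using (true; false; if_then_else_; T)
open import Data.Unit using (tt)
open import Data.Empty using (⊥-elim)
open import Data.Fin using (Fin; toℕ; fromℕ<)
open import Data.Fin.Properties using (all?; toℕ-fromℕ<)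
open import Data.List using (List; []; _∷_; applyUpTo)
open import Function using (_∘_)
open import Relation.Nullary using (Dec)
open import Relation.Nullary.Decidable using (toWitness; _⊎-dec_; _×-dec_; _→-dec_)
open import Relation.Nullary.Reflects using (ofʸ; ofⁿ)
open import Relation.Binary.PropositionalEquality
  using (_≢_; refl; sym; trans; cong; cong₂; subst; subst₂; module ≡-Reasoning)

sumTo-cong : ∀ n {f g} → (∀ i → i ≤ n → f i ≡ g i) → sumTo n f ≡ sumTo n g
sumTo-cong zero    f≡g = f≡g 0 z≤n
sumTo-cong (suc n) f≡g =
  cong₂ _+_ (sumTo-cong n (λ i i≤n → f≡g i (ℕₚ.m≤n⇒m≤1+n i≤n))) (f≡g (suc n) ℕₚ.≤-refl)

sumTo-zero : ∀ n {f} → (∀ i → i ≤ n → f i ≡ 0ℤ) → sumTo n f ≡ 0ℤ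
sumTo-zero zero    f≡0 = f≡0 0 z≤n
sumTo-zero (suc n) f≡0 =
  cong₂ _+_ (sumTo-zero n (λ i i≤n → f≡0 i (ℕₚ.m≤n⇒m≤1+n i≤n))) (f≡0 (suc n) ℕₚ.≤-refl)

sumTo-suc : ∀ n f → sumTo (suc n) f ≡ f 0 + sumTo n (f ∘ suc)
sumTo-suc zero    f = refl
sumTo-suc (suc n) f = trans (cong (_+ f (suc (suc n))) (sumTo-suc n f)) (ℤₚ.+-assoc (f 0) _ _)

sumTo-reverse : ∀ n f → sumTo n f ≡ sumTo n (λ i → f (n ∸ i))
sumTo-reverse zero    f = refl
sumTo-reverse (suc n) f = begin
  sumTo (suc n) f
    ≡⟨ sumTo-suc n f ⟩
  f 0 + sumTo n (f ∘ suc)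
    ≡⟨ cong (_+_ (f 0)) (sumTo-reverse n (f ∘ suc)) ⟩
  f 0 + sumTo n (λ i → f (suc (n ∸ i)))
    ≡⟨ ℤₚ.+-comm (f 0) _ ⟩
  sumTo n (λ i → f (suc (n ∸ i))) + f 0
    ≡⟨ cong₂ _+_ (sumTo-cong n (λ i i≤n → cong f (sym (ℕₚ.+-∸-assoc 1 i≤n)))) (cong f (sym (ℕₚ.n∸n≡0 n))) ⟩
  sumTo (suc n) (λ i → f (suc n ∸ i))
    ∎
  where open ≡-Reasoning

sumTo-last : ∀ n {f} → (∀ i → i < n → f i ≡ 0ℤ) → sumTo n f ≡ f n
sumTo-last zero    _   = refl
sumTo-last (suc n) {f} f≡0 = trans (cong (_+ f (suc n)) (sumTo-zero n (λ i i≤n → f≡0 i (s≤s i≤n)))) (ℤₚ.+-identityˡ _)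

sumTo-head : ∀ n {f} → (∀ i → 0 < i → i ≤ n → f i ≡ 0ℤ) → sumTo n f ≡ f 0
sumTo-head zero    _   = refl
sumTo-head (suc n) {f} f≡0 = begin
  sumTo (suc n) f          ≡⟨ sumTo-suc n f ⟩
  f 0 + sumTo n (f ∘ suc)  ≡⟨ cong (_+_ (f 0)) (sumTo-zero n (λ i i≤n → f≡0 (suc i) (s≤s z≤n) (s≤s i≤n))) ⟩
  f 0 + 0ℤ                 ≡⟨ ℤₚ.+-identityʳ (f 0) ⟩
  f 0                      ∎
  where open ≡-Reasoning

sumTo-vanishing-tail : ∀ k m {f} → (∀ i → m < i → i ≤ k ℕ.+ m → f i ≡ 0ℤ) → sumTo (k ℕ.+ m) f ≡ sumTo m f
sumTo-vanishing-tail zero    m f≡0 = refl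
sumTo-vanishing-tail (suc k) m f≡0 =
  trans (cong₂ _+_ (sumTo-vanishing-tail k m (λ i m<i i≤ → f≡0 i m<i (ℕₚ.m≤n⇒m≤1+n i≤)))
                   (f≡0 (suc (k ℕ.+ m)) (s≤s (ℕₚ.m≤n+m m k)) ℕₚ.≤-refl))
        (ℤₚ.+-identityʳ _)

shift-< : ∀ {s n} f → n < s → shift s f n ≡ 0ℤ
shift-< {s} {n} f n<s with n <ᵇ s | ℕₚ.<ᵇ-reflects-< n s
... | true  | _        = refl
... | false | ofⁿ n≮s = ⊥-elim (n≮s n<s)

shift-≥ : ∀ {s n} f → s ≤ n → shift s f n ≡ f (n ∸ s)
shift-≥ {s} {n} f s≤n with n <ᵇ s | ℕₚ.<ᵇ-reflects-< n s
... | true  | ofʸ n<s = ⊥-elim (ℕₚ.<⇒≱ n<s s≤n)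
... | false | _       = refl

⊛-identityˡ-below : ∀ {l h} g → (∀ i → i < l → h i ≡ one i) → ∀ {n} → n < l → (h ⊛ g) n ≡ g n
⊛-identityˡ-below {l} {h} g h≡one {n} n<l = begin
  sumTo n (λ i → h i * g (n ∸ i))  ≡⟨ sumTo-head n higher-terms-vanish ⟩
  h 0 * g n                        ≡⟨ cong (_* g n) (h≡one 0 (ℕₚ.≤-<-trans z≤n n<l)) ⟩
  1ℤ * g n                         ≡⟨ ℤₚ.*-identityˡ (g n) ⟩
  g n                              ∎
  where
  open ≡-Reasoning
  higher-terms-vanish : ∀ i → 0 < i → i ≤ n → h i * g (n ∸ i) ≡ 0ℤ
  higher-terms-vanish i@(suc _) _ i≤n =
    trans (cong (_* g (n ∸ i)) (h≡one i (ℕₚ.≤-<-trans i≤n n<l))) (ℤₚ.*-zeroˡ (g (n ∸ i)))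

dil-below : ∀ {l f} → f 0 ≡ 1ℤ → ∀ i → i < l → dil l f i ≡ one i
dil-below {l} {f} f0≡1 zero    _   rewrite ℕₚ.*-zeroʳ l = f0≡1
dil-below {l} {f} f0≡1 (suc i) i<l = sumTo-zero (suc i) no-hit
  where
  no-hit : ∀ k → k ≤ suc i → (if l ℕ.* k ≡ᵇ suc i then f k else 0ℤ) ≡ 0ℤ
  no-hit k _ with l ℕ.* k ≡ᵇ suc i in hit
  ... | false = refl
  ... | true  = ⊥-elim (not-hit k (ℕₚ.≡ᵇ⇒≡ (l ℕ.* k) (suc i) (subst T (sym hit) tt)))
    where
    not-hit : ∀ k → l ℕ.* k ≢ suc i
    not-hit zero    lk≡i = ℕₚ.0≢1+n (trans (sym (ℕₚ.*-zeroʳ l)) lk≡i)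
    not-hit (suc k) lk≡i = ℕₚ.<⇒≱ i<l (subst (l ≤_) lk≡i (ℕₚ.m≤m*n l (suc k)))

pow-below : ∀ {l h} → (∀ i → i < l → h i ≡ one i) → ∀ k i → i < l → pow h k i ≡ one i
pow-below h≡one zero    i _   = refl
pow-below h≡one (suc k) i i<l = trans (⊛-identityˡ-below (pow _ k) h≡one i<l) (pow-below h≡one k i i<l)

pow-constant-term : ∀ {f} → f 0 ≡ 1ℤ → ∀ k → pow f k 0 ≡ 1ℤ
pow-constant-term f0≡1 k = pow-below {1} (λ { zero _ → f0≡1 ; (suc _) (s≤s ()) }) k 0 (s≤s z≤n)

term-vanishes : ∀ l c i k {n} → n < l ℕ.* suc l ∸ (l ℕ.* i ℕ.+ k) → term l c i k n ≡ 0ℤ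
term-vanishes l c i k n<e = trans (cong (_*_ c) (shift-< (pow (dil l Jq) i ⊛ pow Jq k) n<e)) (ℤₚ.*-zeroʳ c)

lower-row-exponent : ∀ {l i k n} → i < l → k ≤ l → n < l → n < l ℕ.* suc l ∸ (l ℕ.* i ℕ.+ k)
lower-row-exponent {l} {i} {k} {n} i<l k≤l n<l = ℕₚ.m+n≤o⇒m≤o∸n (suc n) (begin
  suc n ℕ.+ (l ℕ.* i ℕ.+ k) ≤⟨ ℕₚ.+-mono-≤ n<l (ℕₚ.+-monoʳ-≤ (l ℕ.* i) k≤l) ⟩
  l ℕ.+ (l ℕ.* i ℕ.+ l)     ≡⟨ cong (l ℕ.+_) (trans (ℕₚ.+-comm (l ℕ.* i) l) (sym (ℕₚ.*-suc l i))) ⟩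
  l ℕ.+ l ℕ.* suc i         ≤⟨ ℕₚ.+-monoʳ-≤ l (ℕₚ.*-monoʳ-≤ l i<l) ⟩
  l ℕ.+ l ℕ.* l             ≡⟨ ℕₚ.*-suc l l ⟨
  l ℕ.* suc l               ∎)
  where open ℕₚ.≤-Reasoning

Y-power-exponent : ∀ {l n} → 2 ≤ l → n < l → n < l ℕ.* suc l ∸ (l ℕ.* 0 ℕ.+ suc l)
Y-power-exponent {l} {n} 2≤l n<l = ℕₚ.m+n≤o⇒m≤o∸n (suc n) (begin
  suc n ℕ.+ (l ℕ.* 0 ℕ.+ suc l) ≡⟨ cong (λ z → suc n ℕ.+ (z ℕ.+ suc l)) (ℕₚ.*-zeroʳ l) ⟩
  suc n ℕ.+ suc l               ≤⟨ ℕₚ.+-monoˡ-≤ (suc l) n<l ⟩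
  l ℕ.+ suc l                   ≤⟨ ℕₚ.+-monoʳ-≤ l (ℕₚ.+-monoˡ-≤ l (ℕₚ.≤-trans (s≤s z≤n) 2≤l)) ⟩
  l ℕ.+ (l ℕ.+ l)               ≡⟨ cong (λ z → l ℕ.+ (l ℕ.+ z)) (ℕₚ.+-identityʳ l) ⟨
  l ℕ.+ 2 ℕ.* l                 ≤⟨ ℕₚ.+-monoʳ-≤ l (ℕₚ.*-monoˡ-≤ l 2≤l) ⟩
  l ℕ.+ l ℕ.* l                 ≡⟨ ℕₚ.*-suc l l ⟨
  l ℕ.* suc l                   ∎)
  where open ℕₚ.≤-Reasoning

top-row-exponent : ∀ l k → l ℕ.* suc l ∸ (l ℕ.* l ℕ.+ k) ≡ l ∸ k
top-row-exponent l k = trans (cong (_∸ (l ℕ.* l ℕ.+ k)) (trans (ℕₚ.*-suc l l) (ℕₚ.+-comm l (l ℕ.* l))))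
                             (ℕₚ.[m+n]∸[m+o]≡n∸o (l ℕ.* l) l k)

top-row-term : ∀ l c {d} n → d ≤ l →
  term l c l (l ∸ d) n ≡ c * shift d (pow (dil l Jq) l ⊛ pow Jq (l ∸ d)) n
top-row-term l c {d} n d≤l =
  cong (λ s → c * shift s (pow (dil l Jq) l ⊛ pow Jq (l ∸ d)) n)
       (trans (top-row-exponent l (l ∸ d)) (ℕₚ.m∸[m∸n]≡n d≤l))

dil-Jq-power-below : ∀ {l} k i → i < l → pow (dil l Jq) k i ≡ one i
dil-Jq-power-below = pow-below (dil-below refl)

rows-below : ∀ l (a : ℕ → ℕ → ℤ) n → n < l →
  sumTo l (λ i → sumTo l (λ k → term l (a i k) i k n)) ≡ sumTo n (λ d → a l (l ∸ d) * pow Jq (l ∸ d) (n ∸ d))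
rows-below l a n n<l = begin
  sumTo l (λ i → sumTo l (λ k → term l (a i k) i k n))
    ≡⟨ sumTo-last l {row} lower-rows-vanish ⟩
  sumTo l (λ k → term l (a l k) l k n)
    ≡⟨ sumTo-reverse l (λ k → term l (a l k) l k n) ⟩
  sumTo l top-row
    ≡⟨ cong (λ z → sumTo z top-row) (sym (ℕₚ.m∸n+n≡m n≤l)) ⟩
  sumTo (l ∸ n ℕ.+ n) top-row
    ≡⟨ sumTo-vanishing-tail (l ∸ n) n (λ d n<d d≤ → top-row-vanishes n<d (subst (d ≤_) (ℕₚ.m∸n+n≡m n≤l) d≤)) ⟩
  sumTo n top-row
    ≡⟨ sumTo-cong n (λ d → top-row-value) ⟩
  sumTo n (λ d → a l (l ∸ d) * pow Jq (l ∸ d) (n ∸ d))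
    ∎
  where
  open ≡-Reasoning
  n≤l : n ≤ l
  n≤l = ℕₚ.<⇒≤ n<l
  row : ℕ → ℤ
  row i = sumTo l (λ k → term l (a i k) i k n)
  lower-rows-vanish : ∀ i → i < l → row i ≡ 0ℤ
  lower-rows-vanish i i<l = sumTo-zero l (λ k k≤l → term-vanishes l (a i k) i k (lower-row-exponent i<l k≤l n<l))
  top-row : ℕ → ℤ
  top-row d = term l (a l (l ∸ d)) l (l ∸ d) n
  G : ℕ → PS
  G d = pow (dil l Jq) l ⊛ pow Jq (l ∸ d)
  top-row-shift : ∀ {d} → d ≤ l → top-row d ≡ a l (l ∸ d) * shift d (G d) n
  top-row-shift {d} = top-row-term l (a l (l ∸ d)) n
  top-row-vanishes : ∀ {d} → n < d → d ≤ l → top-row d ≡ 0ℤ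
  top-row-vanishes {d} n<d d≤l =
    trans (top-row-shift d≤l) (trans (cong (_*_ (a l (l ∸ d))) (shift-< (G d) n<d)) (ℤₚ.*-zeroʳ (a l (l ∸ d))))
  top-row-value : ∀ {d} → d ≤ n → top-row d ≡ a l (l ∸ d) * pow Jq (l ∸ d) (n ∸ d)
  top-row-value {d} d≤n = trans (top-row-shift (ℕₚ.≤-trans d≤n n≤l)) (cong (_*_ (a l (l ∸ d))) (begin
    shift d (G d) n        ≡⟨ shift-≥ (G d) d≤n ⟩
    G d (n ∸ d)            ≡⟨ ⊛-identityˡ-below (pow Jq (l ∸ d)) (dil-Jq-power-below l) n∸d<l ⟩
    pow Jq (l ∸ d) (n ∸ d) ∎))
    where
    n∸d<l : n ∸ d < l
    n∸d<l = ℕₚ.≤-<-trans (ℕₚ.m∸n≤m n d) n<l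

evalPhi-below : ∀ l (a : ℕ → ℕ → ℤ) n → 2 ≤ l → n < l →
  evalPhi l a n ≡ one n + sumTo n (λ d → a l (l ∸ d) * pow Jq (l ∸ d) (n ∸ d))
evalPhi-below l a n 2≤l n<l = begin
  evalPhi l a n           ≡⟨ cong₂ (λ x y → x + y + rows) X-term Y-term ⟩
  one n + 0ℤ + rows       ≡⟨ cong (_+ rows) (ℤₚ.+-identityʳ (one n)) ⟩
  one n + rows            ≡⟨ cong (_+_ (one n)) (rows-below l a n n<l) ⟩
  one n + sumTo n (λ d → a l (l ∸ d) * pow Jq (l ∸ d) (n ∸ d)) ∎
  where
  open ≡-Reasoning
  rows : ℤ
  rows = sumTo l (λ i → sumTo l (λ k → term l (a i k) i k n))
  Y-term : term l 1ℤ 0 (suc l) n ≡ 0ℤ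
  Y-term = term-vanishes l 1ℤ 0 (suc l) (Y-power-exponent 2≤l n<l)
  X-term : term l 1ℤ (suc l) 0 n ≡ one n
  X-term = begin
    term l 1ℤ (suc l) 0 n
      ≡⟨ cong (λ s → 1ℤ * shift s (pow (dil l Jq) (suc l) ⊛ one) n)
              (trans (cong (l ℕ.* suc l ∸_) (ℕₚ.+-identityʳ (l ℕ.* suc l))) (ℕₚ.n∸n≡0 (l ℕ.* suc l))) ⟩
    1ℤ * (pow (dil l Jq) (suc l) ⊛ one) n ≡⟨ ℤₚ.*-identityˡ _ ⟩
    (pow (dil l Jq) (suc l) ⊛ one) n      ≡⟨ ⊛-identityˡ-below one (dil-Jq-power-below (suc l)) n<l ⟩
    one n ∎

module Congruence (d : ℕ) .{{_ : NonZero d}} where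

  infix 4 _≈_ _≈ᵣ_

  record _≈_ (x y : ℤ) : Set where
    constructor divides-difference
    field difference : + d ∣ₛ x - y

  open _≈_

  private
    ≈-by : ∀ {x y z} → x - y ≡ z → + d ∣ₛ z → x ≈ y
    ≈-by eq d∣z = divides-difference (subst (+ d ∣ₛ_) (sym eq) d∣z)

    difference-of-sums : ∀ x y x′ y′ → (x + y) - (x′ + y′) ≡ (x - x′) + (y - y′)
    difference-of-sums = solve-∀

    difference-of-products : ∀ x y x′ y′ → x * y - x′ * y′ ≡ (x - x′) * y + x′ * (y - y′)
    difference-of-products = solve-∀

    difference-via : ∀ x y z → x - z ≡ (x - y) + (y - z)
    difference-via = solve-∀

    negated-difference : ∀ x y → - x - - y ≡ - (x - y)
    negated-difference = solve-∀

    shifted-difference : ∀ y k m → (y + k * m) - y ≡ k * m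
    shifted-difference = solve-∀

    negation-as-complement : ∀ u v → - v ≡ u + - 1ℤ * (u + v)
    negation-as-complement = solve-∀

  ≈-refl : ∀ {x} → x ≈ x
  ≈-refl {x} = ≈-by (ℤₚ.+-inverseʳ x) (divides 0ℤ refl)

  ≈-trans : ∀ {x y z} → x ≈ y → y ≈ z → x ≈ z
  ≈-trans {x} {y} {z} x≈y y≈z = ≈-by (difference-via x y z) (Signed.∣m∣n⇒∣m+n (difference x≈y) (difference y≈z))

  +-cong : ∀ {x x′ y y′} → x ≈ x′ → y ≈ y′ → x + y ≈ x′ + y′
  +-cong {x} {x′} {y} {y′} x≈x′ y≈y′ =
    ≈-by (difference-of-sums x y x′ y′) (Signed.∣m∣n⇒∣m+n (difference x≈x′) (difference y≈y′))

  *-cong : ∀ {x x′ y y′} → x ≈ x′ → y ≈ y′ → x * y ≈ x′ * y′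
  *-cong {x} {x′} {y} {y′} x≈x′ y≈y′ =
    ≈-by (difference-of-products x y x′ y′)
         (Signed.∣m∣n⇒∣m+n (Signed.∣m⇒∣m*n y (difference x≈x′)) (Signed.∣n⇒∣m*n x′ (difference y≈y′)))

  -‿cong : ∀ {x y} → x ≈ y → - x ≈ - y
  -‿cong {x} {y} x≈y = ≈-by (negated-difference x y) (Signed.∣m⇒∣-m (difference x≈y))

  +-multiple-≈ : ∀ y k → y + k * + d ≈ y
  +-multiple-≈ y k = ≈-by (shifted-difference y k (+ d)) (divides k refl)

  _≈ᵣ_ : ℤ → ℕ → Set
  x ≈ᵣ a = x ≈ + a

  %ℕ-≈ᵣ : ∀ x → x ≈ᵣ x %ℕ d
  %ℕ-≈ᵣ x = subst (_≈ᵣ x %ℕ d) (sym (a≡a%ℕn+[a/ℕn]*n x d)) (+-multiple-≈ (+ (x %ℕ d)) (x /ℕ d))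

  pos-≈ᵣ : ∀ n → + n ≈ᵣ n % d
  pos-≈ᵣ n = %ℕ-≈ᵣ (+ n)

  neg-pos-≈ᵣ : ∀ {k} → k ≤ d → - + k ≈ᵣ d ∸ k
  neg-pos-≈ᵣ {k} k≤d = subst (_≈ᵣ d ∸ k) (sym -k≡d∸k-d) (+-multiple-≈ (+ (d ∸ k)) (- 1ℤ))
    where
    -k≡d∸k-d : - + k ≡ + (d ∸ k) + - 1ℤ * + d
    -k≡d∸k-d = trans (negation-as-complement (+ (d ∸ k)) (+ k))
                     (cong (λ z → + (d ∸ k) + - 1ℤ * z)
                           (trans (sym (ℤₚ.pos-+ (d ∸ k) k)) (cong +_ (ℕₚ.m∸n+n≡m k≤d))))

  infixl 6 _+ᵣ_
  infixl 7 _*ᵣ_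

  _+ᵣ_ : ℕ → ℕ → ℕ
  a +ᵣ b = (a ℕ.+ b) % d

  _*ᵣ_ : ℕ → ℕ → ℕ
  a *ᵣ b = (a ℕ.* b) % d

  -ᵣ_ : ℕ → ℕ
  -ᵣ a = (d ∸ a % d) % d

  +-≈ᵣ : ∀ {x y a b} → x ≈ᵣ a → y ≈ᵣ b → x + y ≈ᵣ a +ᵣ b
  +-≈ᵣ {a = a} {b} x≈a y≈b = ≈-trans (+-cong x≈a y≈b) (subst (_≈ᵣ a +ᵣ b) (ℤₚ.pos-+ a b) (pos-≈ᵣ (a ℕ.+ b)))

  *-≈ᵣ : ∀ {x y a b} → x ≈ᵣ a → y ≈ᵣ b → x * y ≈ᵣ a *ᵣ b
  *-≈ᵣ {a = a} {b} x≈a y≈b = ≈-trans (*-cong x≈a y≈b) (subst (_≈ᵣ a *ᵣ b) (ℤₚ.pos-* a b) (pos-≈ᵣ (a ℕ.* b)))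

  neg-≈ᵣ : ∀ {x a} → x ≈ᵣ a → - x ≈ᵣ -ᵣ a
  neg-≈ᵣ {a = a} x≈a = ≈-trans (-‿cong (≈-trans x≈a (pos-≈ᵣ a)))
                        (≈-trans (neg-pos-≈ᵣ (ℕₚ.m%n≤n a d)) (pos-≈ᵣ (d ∸ a % d)))

  sumᵣ : ℕ → (ℕ → ℕ) → ℕ
  sumᵣ zero    F = F zero
  sumᵣ (suc n) F = sumᵣ n F +ᵣ F (suc n)

  sumTo-≈ᵣ : ∀ n {f F} → (∀ i → i ≤ n → f i ≈ᵣ F i) → sumTo n f ≈ᵣ sumᵣ n F
  sumTo-≈ᵣ zero    f≈F = f≈F 0 z≤n
  sumTo-≈ᵣ (suc n) f≈F =
    +-≈ᵣ (sumTo-≈ᵣ n (λ i i≤n → f≈F i (ℕₚ.m≤n⇒m≤1+n i≤n))) (f≈F (suc n) ℕₚ.≤-refl)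

  ≈ᵣ0⇒∣ : ∀ {x} → x ≈ᵣ 0 → + d ∣ x
  ≈ᵣ0⇒∣ {x} x≈0 = Signed.∣⇒∣ᵤ (subst (+ d ∣ₛ_) (ℤₚ.+-identityʳ x) (difference x≈0))

coeff : List ℕ → ℕ → ℕ
coeff []       _       = 0
coeff (x ∷ _)  zero    = x
coeff (_ ∷ xs) (suc i) = coeff xs i

coeff-applyUpTo : ∀ h {n i} → i < n → coeff (applyUpTo h n) i ≡ h i
coeff-applyUpTo h {suc n} {zero}  _         = refl
coeff-applyUpTo h {suc n} {suc i} (s≤s i<n) = coeff-applyUpTo (h ∘ suc) i<n

-- Power series modulo (d, q^N), stored as lists rather than functions so that evaluating a
-- power shares its intermediate products; this is what makes the final case check feasible.
module ResidueSeries (d N : ℕ) .{{_ : NonZero d}} where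
  open Congruence d

  truncate : (ℕ → ℕ) → List ℕ
  truncate h = applyUpTo h N

  reduce : PS → List ℕ
  reduce f = truncate (λ i → f i %ℕ d)

  infixl 7 _⊛ᵣ_

  _⊛ᵣ_ : List ℕ → List ℕ → List ℕ
  F ⊛ᵣ G = truncate (λ n → sumᵣ n (λ i → coeff F i *ᵣ coeff G (n ∸ i)))

  powᵣ : List ℕ → ℕ → List ℕ
  powᵣ F zero    = reduce one
  powᵣ F (suc k) = F ⊛ᵣ powᵣ F k

  infix 4 _≅_

  record _≅_ (f : PS) (F : List ℕ) : Set where
    constructor coeffs-≈ᵣ
    field coeff-≈ᵣ : ∀ i → i < N → f i ≈ᵣ coeff F i

  open _≅_

  reduce-≅ : ∀ f → f ≅ reduce f
  reduce-≅ f = coeffs-≈ᵣ λ i i<N → subst (f i ≈ᵣ_) (sym (coeff-applyUpTo _ i<N)) (%ℕ-≈ᵣ (f i))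

  ⊛-≅ : ∀ {f g F G} → f ≅ F → g ≅ G → f ⊛ g ≅ F ⊛ᵣ G
  ⊛-≅ f≅F g≅G = coeffs-≈ᵣ λ n n<N → subst (_ ≈ᵣ_) (sym (coeff-applyUpTo _ n<N))
    (sumTo-≈ᵣ n (λ i i≤n → *-≈ᵣ (coeff-≈ᵣ f≅F i (ℕₚ.≤-<-trans i≤n n<N))
                                (coeff-≈ᵣ g≅G (n ∸ i) (ℕₚ.≤-<-trans (ℕₚ.m∸n≤m n i) n<N))))

  pow-≅ : ∀ {f F} → f ≅ F → ∀ k → pow f k ≅ powᵣ F k
  pow-≅ f≅F zero    = reduce-≅ one
  pow-≅ f≅F (suc k) = ⊛-≅ f≅F (pow-≅ f≅F k)

  module _ (F : List ℕ) (P : ℕ) (period : powᵣ F P ≡ reduce one) where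

    powᵣ-+-period : ∀ k → powᵣ F (k ℕ.+ P) ≡ powᵣ F k
    powᵣ-+-period zero    = period
    powᵣ-+-period (suc k) = cong (F ⊛ᵣ_) (powᵣ-+-period k)

    powᵣ-+-multiple : ∀ k j → powᵣ F (k ℕ.+ j ℕ.* P) ≡ powᵣ F k
    powᵣ-+-multiple k zero    = cong (powᵣ F) (ℕₚ.+-identityʳ k)
    powᵣ-+-multiple k (suc j) = begin
      powᵣ F (k ℕ.+ (P ℕ.+ j ℕ.* P)) ≡⟨ cong (λ e → powᵣ F (k ℕ.+ e)) (ℕₚ.+-comm P (j ℕ.* P)) ⟩
      powᵣ F (k ℕ.+ (j ℕ.* P ℕ.+ P)) ≡⟨ cong (powᵣ F) (ℕₚ.+-assoc k (j ℕ.* P) P) ⟨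
      powᵣ F (k ℕ.+ j ℕ.* P ℕ.+ P)   ≡⟨ powᵣ-+-period (k ℕ.+ j ℕ.* P) ⟩
      powᵣ F (k ℕ.+ j ℕ.* P)         ≡⟨ powᵣ-+-multiple k j ⟩
      powᵣ F k                        ∎
      where open ≡-Reasoning

  -- Residues of the solution x₀, …, xₙ of Σ_{i ≤ k} xᵢ cᵢ(k − i) = −[k = 0] (k ≤ n) when each cᵢ
  -- has constant term 1 and reduces to Cᵢ; listed newest first so that each step shares the last.
  forced : (ℕ → List ℕ) → ℕ → List ℕ
  forced C zero    = -ᵣ 1 ∷ []
  forced C (suc n) = -ᵣ sumᵣ n (λ i → coeff (forced C n) (n ∸ i) *ᵣ coeff (C i) (suc n ∸ i)) ∷ forced C n

  module TriangularSystem
    (A : ℕ → ℤ) (c : ℕ → PS) (C : ℕ → List ℕ) (M : ℕ) (M<N : M < N)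
    (unit-diagonal : ∀ i → i ≤ M → c i 0 ≡ 1ℤ)
    (c≅C : ∀ i → i ≤ M → c i ≅ C i)
    (equations : ∀ k → k ≤ M → one k + sumTo k (λ i → A i * c i (k ∸ i)) ≡ 0ℤ)
    where

    private
      diagonal-unknown : ∀ {u x c₀ s} → u + x * c₀ ≡ 0ℤ → c₀ ≡ 1ℤ → u ≈ᵣ s → x ≈ᵣ -ᵣ s
      diagonal-unknown {u} {x} eq refl u≈s = subst (_≈ᵣ _) (sym x≡-u) (neg-≈ᵣ u≈s)
        where
        x≡-u : x ≡ - u
        x≡-u = begin
          x                   ≡⟨ rearranged u x ⟩
          - u + (u + x * 1ℤ)  ≡⟨ cong (λ z → - u + z) eq ⟩
          - u + 0ℤ            ≡⟨ ℤₚ.+-identityʳ (- u) ⟩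
          - u                 ∎
          where
          open ≡-Reasoning
          rearranged : ∀ u x → x ≡ - u + (u + x * 1ℤ)
          rearranged = solve-∀

    forced-≈ᵣ : ∀ n → n ≤ M → ∀ j → j ≤ n → A (n ∸ j) ≈ᵣ coeff (forced C n) j
    forced-≈ᵣ zero    _   zero    _ = diagonal-unknown (equations 0 z≤n) (unit-diagonal 0 z≤n) ≈-refl
    forced-≈ᵣ (suc n) n<M zero    _ =
      diagonal-unknown last-equation (unit-diagonal (suc n) n<M) (sumTo-≈ᵣ n earlier-terms)
      where
      n≤M : n ≤ M
      n≤M = ℕₚ.≤-trans (ℕₚ.n≤1+n n) n<M
      last-equation : sumTo n (λ i → A i * c i (suc n ∸ i)) + A (suc n) * c (suc n) 0 ≡ 0ℤ
      last-equation = begin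
        sumTo n (λ i → A i * c i (suc n ∸ i)) + A (suc n) * c (suc n) 0
          ≡⟨ cong (λ z → sumTo n (λ i → A i * c i (suc n ∸ i)) + A (suc n) * c (suc n) z) (ℕₚ.n∸n≡0 n) ⟨
        sumTo (suc n) (λ i → A i * c i (suc n ∸ i))
          ≡⟨ ℤₚ.+-identityˡ _ ⟨
        one (suc n) + sumTo (suc n) (λ i → A i * c i (suc n ∸ i))
          ≡⟨ equations (suc n) n<M ⟩
        0ℤ ∎
        where open ≡-Reasoning
      earlier-terms : ∀ i → i ≤ n →
        A i * c i (suc n ∸ i) ≈ᵣ coeff (forced C n) (n ∸ i) *ᵣ coeff (C i) (suc n ∸ i)
      earlier-terms i i≤n = *-≈ᵣ
        (subst (λ k → A k ≈ᵣ coeff (forced C n) (n ∸ i)) (ℕₚ.m∸[m∸n]≡n i≤n)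
               (forced-≈ᵣ n n≤M (n ∸ i) (ℕₚ.m∸n≤m n i)))
        (coeff-≈ᵣ (c≅C i (ℕₚ.≤-trans i≤n n≤M)) (suc n ∸ i)
                  (ℕₚ.≤-<-trans (ℕₚ.m∸n≤m (suc n) i) (ℕₚ.≤-<-trans n<M M<N)))
    forced-≈ᵣ (suc n) n<M (suc j) (s≤s j≤n) = forced-≈ᵣ n (ℕₚ.≤-trans (ℕₚ.n≤1+n n) n<M) j j≤n

open Congruence 5
open ResidueSeries 5 8

Jᵣ : List ℕ
Jᵣ = powᵣ (reduce E4) 3 ⊛ᵣ powᵣ (reduce eulerInv) 24

Jq≅Jᵣ : Jq ≅ Jᵣ
Jq≅Jᵣ = ⊛-≅ (pow-≅ (reduce-≅ E4) 3) (pow-≅ (reduce-≅ eulerInv) 24)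

Jᵣ-period : powᵣ Jᵣ 25 ≡ reduce one
Jᵣ-period = refl

-- J^{ℓ−d} from r = ℓ mod 25; the extra period 25 keeps r + 25 ∸ d from truncating at 0.
Jpowerᵣ : ℕ → ℕ → List ℕ
Jpowerᵣ r d = powᵣ Jᵣ (r ℕ.+ 25 ∸ d)

m∸n+o≡m%o+o∸n+[m/o]*o : ∀ {m n} o .{{_ : NonZero o}} → n ≤ m → n ≤ o →
  m ∸ n ℕ.+ o ≡ m % o ℕ.+ o ∸ n ℕ.+ (m / o) ℕ.* o
m∸n+o≡m%o+o∸n+[m/o]*o {m} {n} o n≤m n≤o = begin
  m ∸ n ℕ.+ o                             ≡⟨ ℕₚ.+-∸-comm o n≤m ⟨
  m ℕ.+ o ∸ n                             ≡⟨ cong (λ z → z ℕ.+ o ∸ n) (ℕₚ.m≡m%n+[m/n]*n m o) ⟩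
  m % o ℕ.+ (m / o) ℕ.* o ℕ.+ o ∸ n       ≡⟨ cong (_∸ n) (ℕₚ.+-assoc (m % o) _ o) ⟩
  m % o ℕ.+ ((m / o) ℕ.* o ℕ.+ o) ∸ n     ≡⟨ cong (λ z → m % o ℕ.+ z ∸ n) (ℕₚ.+-comm _ o) ⟩
  m % o ℕ.+ (o ℕ.+ (m / o) ℕ.* o) ∸ n     ≡⟨ cong (_∸ n) (ℕₚ.+-assoc (m % o) o _) ⟨
  m % o ℕ.+ o ℕ.+ (m / o) ℕ.* o ∸ n       ≡⟨ ℕₚ.+-∸-comm _ (ℕₚ.≤-trans n≤o (ℕₚ.m≤n+m o (m % o))) ⟩
  m % o ℕ.+ o ∸ n ℕ.+ (m / o) ℕ.* o       ∎
  where open ≡-Reasoning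

pow-Jq≅Jpowerᵣ : ∀ {l d} → d ≤ l → d ≤ 25 → pow Jq (l ∸ d) ≅ Jpowerᵣ (l % 25) d
pow-Jq≅Jpowerᵣ {l} {d} d≤l d≤25 = subst (pow Jq (l ∸ d) ≅_) same-power (pow-≅ Jq≅Jᵣ (l ∸ d))
  where
  open ≡-Reasoning
  same-power : powᵣ Jᵣ (l ∸ d) ≡ Jpowerᵣ (l % 25) d
  same-power = begin
    powᵣ Jᵣ (l ∸ d)
      ≡⟨ powᵣ-+-period Jᵣ 25 Jᵣ-period (l ∸ d) ⟨
    powᵣ Jᵣ (l ∸ d ℕ.+ 25)
      ≡⟨ cong (powᵣ Jᵣ) (m∸n+o≡m%o+o∸n+[m/o]*o 25 d≤l d≤25) ⟩
    powᵣ Jᵣ (l % 25 ℕ.+ 25 ∸ d ℕ.+ (l / 25) ℕ.* 25)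
      ≡⟨ powᵣ-+-multiple Jᵣ 25 Jᵣ-period (l % 25 ℕ.+ 25 ∸ d) (l / 25) ⟩
    Jpowerᵣ (l % 25) d
      ∎

ResidueCondition : ℕ → ℕ → Set
ResidueCondition ℓ₅ m =
  ((ℓ₅ ≡ 1 ⊎ ℓ₅ ≡ 3) × m % 5 ≡ 4) ⊎ (ℓ₅ ≡ 2 × m % 5 ≡ 3) ⊎ (ℓ₅ ≡ 4 × m % 5 ≡ 2)

residueCondition? : ∀ ℓ₅ m → Dec (ResidueCondition ℓ₅ m)
residueCondition? ℓ₅ m = (((ℓ₅ ℕₚ.≟ 1) ⊎-dec (ℓ₅ ℕₚ.≟ 3)) ×-dec (m % 5 ℕₚ.≟ 4))
                       ⊎-dec ((ℓ₅ ℕₚ.≟ 2) ×-dec (m % 5 ℕₚ.≟ 3))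
                       ⊎-dec ((ℓ₅ ℕₚ.≟ 4) ×-dec (m % 5 ℕₚ.≟ 2))

forced-top-vanishes : ∀ {r m} → r < 25 → m < 8 →
  ResidueCondition (r % 5) m → coeff (forced (Jpowerᵣ r) m) 0 ≡ 0
forced-top-vanishes r<25 m<8 =
  subst₂ Vanishes (toℕ-fromℕ< r<25) (toℕ-fromℕ< m<8) (by-computation (fromℕ< r<25) (fromℕ< m<8))
  where
  Vanishes : ℕ → ℕ → Set
  Vanishes r m = ResidueCondition (r % 5) m → coeff (forced (Jpowerᵣ r) m) 0 ≡ 0
  by-computation : ∀ (r : Fin 25) (m : Fin 8) → Vanishes (toℕ r) (toℕ m)
  by-computation = toWitness {a? = all? λ r → all? λ m →
    residueCondition? (toℕ r % 5) (toℕ m) →-dec coeff (forced (Jpowerᵣ (toℕ r)) (toℕ m)) 0 ℕₚ.≟ 0} tt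

proposition2p8 : (l m : ℕ) → Prime l → 0 < m → m < l → m ≤ 7 →
  (a : ℕ → ℕ → ℤ) → IsModularPolyCoeffs l a →
  (((l % 5 ≡ 1 ⊎ l % 5 ≡ 3) × m % 5 ≡ 4)
    ⊎ (l % 5 ≡ 2 × m % 5 ≡ 3)
    ⊎ (l % 5 ≡ 4 × m % 5 ≡ 2)) →
  (+ 5) ∣ a l (l ∸ m)
proposition2p8 l m _ 0<m m<l m≤7 a Φ-vanishes condition =
  ≈ᵣ0⇒∣ (subst (a l (l ∸ m) ≈ᵣ_) top-residue (forced-≈ᵣ m ℕₚ.≤-refl 0 z≤n))
  where
  low-order-equations : ∀ n → n ≤ m → one n + sumTo n (λ d → a l (l ∸ d) * pow Jq (l ∸ d) (n ∸ d)) ≡ 0ℤ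
  low-order-equations n n≤m =
    trans (sym (evalPhi-below l a n (ℕₚ.≤-trans (s≤s 0<m) m<l) (ℕₚ.≤-<-trans n≤m m<l))) (Φ-vanishes n)

  J-powers-reduce : ∀ d → d ≤ m → pow Jq (l ∸ d) ≅ Jpowerᵣ (l % 25) d
  J-powers-reduce d d≤m =
    pow-Jq≅Jpowerᵣ (ℕₚ.≤-trans d≤m (ℕₚ.<⇒≤ m<l))
                   (ℕₚ.≤-trans d≤m (ℕₚ.≤-trans m≤7 (ℕₚ.m≤m+n 7 18)))

  open TriangularSystem (λ d → a l (l ∸ d)) (λ d → pow Jq (l ∸ d)) (Jpowerᵣ (l % 25)) m (s≤s m≤7)
    (λ d _ → pow-constant-term refl (l ∸ d)) J-powers-reduce low-order-equations

  top-residue : coeff (forced (Jpowerᵣ (l % 25)) m) 0 ≡ 0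
  top-residue = forced-top-vanishes (ℕₚ.m%n<n l 25) (s≤s m≤7)
    (subst (λ ℓ₅ → ResidueCondition ℓ₅ m) (sym (ℕₚ.m∣n⇒o%n%m≡o%m 5 25 l (divides 5 refl))) condition)
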